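{- Let $G$ be a finite group and $H$ a subgroup of index $[G:H]=k+1$. Let $S\subset G$ be a subset with $S_H=S\cap H$ symmetric, and consider the pair graph $\mathcal{G}(G,H,S)$. If $x_1,\ldots,x_k$ are representatives of the right cosets of $H$ different from $H$, then for every $h\in H$, \[\deg(h)=|S|\geq \sum_{i=1}^k |Hx_i\cap S_O| = |S_O| = \sum_{i=1}^k \deg(x_i),\] with equality only when $S_H=\emptyset$. In particular, a nontrivial pair graph $\mathcal{G}(G,H,S)$ is regular if and only if either $S_H=\emptyset$ and $[G:H]=2$, or $[G:H]=1$.
   Context: A subset $X\subset G$ is symmetric if $X^{ -1}=X$. Write $S_H=S\cap H$ and $S_O=S\setminus H$. The group-subgroup pair graph $\mathcal{G}(G,H,S)$ is the undirected graph with vertex set $G$ whose edges are exactly the pairs $\{h,hs\}$ with $h\in H$, $s\in S$. It is called trivial if $S=\emptyset$, nontrivial otherwise. A graph is regular if all vertices have the same degree. -}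

module Defs where

open import Data.Nat using (ℕ)
open import Data.Fin using (Fin)
open import Data.Fin.Properties using (_≟_; any?)
open import Data.Fin.Subset using (Subset; _∈_; _∉_; _∩_; _─_; ∣_∣; Nonempty; Empty)
open import Data.Fin.Subset.Properties using (_∈?_)
open import Data.Vec using (tabulate)
open import Data.Product using (_×_; ∃; _,_)
open import Data.Sum using (_⊎_)
open import Relation.Nullary using (Dec; does; yes; no)
open import Relation.Nullary.Decidable using (_×-dec_; _⊎-dec_)
open import Relation.Binary.PropositionalEquality using (_≡_)
open import Algebra.Structures using (IsGroup)
open import Data.List using (List)
import Data.List as List
open import Data.Nat.ListAction using (sum)

-- A finite group: WLOG its underlying set is Fin order (any finite group is
-- isomorphic to one of this form), with propositional equality.
record FinGroup : Set where
  field
    order   : ℕ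
    _∙_     : Fin order → Fin order → Fin order
    ε       : Fin order
    _⁻¹     : Fin order → Fin order
    isGroup : IsGroup _≡_ _∙_ ε _⁻¹
  infixl 7 _∙_
  infix 8 _⁻¹

module _ (G : FinGroup) where
  open FinGroup G

  IsSubgroup : Subset order → Set
  IsSubgroup H = (ε ∈ H)
               × (∀ a b → a ∈ H → b ∈ H → (a ∙ b) ∈ H)
               × (∀ a → a ∈ H → (a ⁻¹) ∈ H)

  Symmetric : Subset order → Set
  Symmetric X = ∀ a → (a ∈ X → (a ⁻¹) ∈ X) × ((a ⁻¹) ∈ X → a ∈ X)

  RightCoset : Subset order → Fin order → Subset order
  RightCoset H x = tabulate (λ g → does ((g ∙ x ⁻¹) ∈? H))

  -- x 0, ..., x (k-1) are representatives of the right cosets of H different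
  -- from H itself (so [G : H] = k + 1)
  NontrivialRightCosetReps : Subset order → (k : ℕ) → (Fin k → Fin order) → Set
  NontrivialRightCosetReps H k x =
      (∀ i → x i ∉ H)
    × (∀ i j → (x i ∙ x j ⁻¹) ∈ H → i ≡ j)
    × (∀ g → g ∉ H → ∃ λ i → (g ∙ x i ⁻¹) ∈ H)

  Adj : Subset order → Subset order → Fin order → Fin order → Set
  Adj H S u v = (u ∈ H × ∃ λ s → s ∈ S × v ≡ u ∙ s)
              ⊎ (v ∈ H × ∃ λ s → s ∈ S × u ≡ v ∙ s)

  Adj? : ∀ H S u v → Dec (Adj H S u v)
  Adj? H S u v =
        ((u ∈? H) ×-dec any? (λ s → (s ∈? S) ×-dec (v ≟ u ∙ s)))
    ⊎-dec ((v ∈? H) ×-dec any? (λ s → (s ∈? S) ×-dec (u ≟ v ∙ s)))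

  -- the set of neighbours of u, and the degree of u (number of neighbours;
  -- a loop contributes the vertex itself once)
  neighbours : Subset order → Subset order → Fin order → Subset order
  neighbours H S u = tabulate (λ v → does (Adj? H S u v))

  deg : Subset order → Subset order → Fin order → ℕ
  deg H S u = ∣ neighbours H S u ∣

  Regular : Subset order → Subset order → Set
  Regular H S = ∀ u v → deg H S u ≡ deg H S v

Σ[<_]_ : (k : ℕ) → (Fin k → ℕ) → ℕ
Σ[< k ] f = sum (List.tabulate f)

-- Left multiplication by h⁻¹ maps the neighbourhood of h ∈ H onto S: an edge {h, hs} gives
-- h⁻¹(hs) = s, and an edge {v, vs = h} with v ∈ H forces s ∈ S ∩ H, whose symmetry gives
-- h⁻¹v = s⁻¹ ∈ S. A vertex g ∉ H is adjacent exactly to the v ∈ H with v⁻¹g ∈ S, and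
-- v ↦ v⁻¹g maps its neighbourhood onto Hg ∩ S_O. The cosets Hxᵢ partition G ∖ H, so the
-- degrees of the xᵢ add up to |S_O| ≤ |S|, with equality iff S_H = ∅. A regular graph thus
-- has |S| = deg xᵢ for every i, which forces k ≤ 1, and S_H = ∅ when k = 1.

module Submission where

open import Defs
open import Data.Nat using (ℕ; _≤_; _<_; suc; zero; _+_)
open import Data.Nat.Properties
  using (+-0-commutativeMonoid; +-identityʳ; m≤m+n; m<m+n; ≤-trans; ≤-reflexive; +-monoʳ-≤; <-irrefl; <-≤-trans; module ≤-Reasoning)
open import Data.Fin using (Fin; zero; suc; punchIn)
open import Data.Fin.Properties using (punchInᵢ≢i)
open import Data.Fin.Permutation using (Permutation′; permutation; _⟨$⟩ʳ_)
open import Data.Fin.Subset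
  using (Subset; _∈_; _∉_; _⊆_; _∩_; _─_; ∣_∣; Nonempty; Empty; inside; outside)
open import Data.Fin.Subset.Properties
  using (_∈?_; x∈p∩q⁺; x∈p∩q⁻; x∈p∧x∉q⇒x∈p─q; p─q⊆p; p⊆q⇒∣p∣≤∣q∣; x∈⁅y⁆⇒x≡y; ∣⁅x⁆∣≡1;
         Empty-unique; ∣⊥∣≡0; p∩q≢∅⇒∣p─q∣<∣p∣; ∣p─q∣≤∣p∣; ⊆-antisym)
open import Data.Vec using ([]; _∷_; here; there; lookup; tabulate)
open import Data.Vec.Properties using ([]=⇒lookup; lookup⇒[]=; lookup∘tabulate)
open import Data.Bool using (true; false; if_then_else_)
open import Data.Product using (_×_; _,_; ∃; proj₁; proj₂)
open import Data.Sum using (_⊎_; inj₁; inj₂)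
open import Data.Empty using (⊥-elim)
open import Data.List.Properties using (tabulate-cong)
open import Data.Nat.ListAction using () renaming (sum to sumᴸ)
open import Function using (_∘_)
open import Function.Bundles using (_⇔_; mk⇔; Equivalence)
open import Level using (0ℓ)
open import Relation.Nullary using (Dec; yes; no; does)
open import Relation.Nullary.Decidable using (dec-true)
open import Relation.Unary using (Pred; Decidable)
open import Relation.Binary.PropositionalEquality
  using (_≡_; _≢_; refl; sym; trans; cong; cong₂; subst)
open import Relation.Binary.PropositionalEquality.Properties using (module ≡-Reasoning)
open import Algebra.Bundles using (Group)
open import Algebra.Structures using (IsGroup)
import Algebra.Properties.Group as GroupProperties
open import Algebra.Properties.CommutativeMonoid.Sum +-0-commutativeMonoid
  using (sum; sum-cong-≗; sum-remove; sum-replicate-zero; ∑-comm; ∑-permute; ∑-distrib-+)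

open Equivalence using (to; from)

private variable n : ℕ

sum-zero : ∀ {k} (f : Fin k → ℕ) → (∀ i → f i ≡ 0) → sum f ≡ 0
sum-zero {k} f f≡0 = trans (sum-cong-≗ f≡0) (sum-replicate-zero k)

sum-single : ∀ {k} (f : Fin k → ℕ) i → f i ≡ 1 → (∀ j → j ≢ i → f j ≡ 0) → sum f ≡ 1
sum-single {suc _} f i fi≡1 fj≡0 = begin
  sum f                          ≡⟨ sum-remove {i = i} f ⟩
  f i + sum (f ∘ punchIn i)      ≡⟨ cong₂ _+_ fi≡1 (sum-zero _ (λ j → fj≡0 _ (punchInᵢ≢i i j))) ⟩
  1                              ∎
  where open ≡-Reasoning

Σ[<]≡sum : ∀ {k} (f : Fin k → ℕ) → Σ[< k ] f ≡ sum f
Σ[<]≡sum {zero}  f = refl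
Σ[<]≡sum {suc k} f = cong (f zero +_) (Σ[<]≡sum (f ∘ suc))

indicator : Subset n → Fin n → ℕ
indicator p x = if lookup p x then 1 else 0

∣p∣≡∑indicator : (p : Subset n) → ∣ p ∣ ≡ sum (indicator p)
∣p∣≡∑indicator []            = refl
∣p∣≡∑indicator (inside  ∷ p) = cong suc (∣p∣≡∑indicator p)
∣p∣≡∑indicator (outside ∷ p) = ∣p∣≡∑indicator p

indicator-∈ : ∀ {p : Subset n} {x} → x ∈ p → indicator p x ≡ 1
indicator-∈ x∈p rewrite []=⇒lookup x∈p = refl

indicator-∉ : ∀ {p : Subset n} {x} → x ∉ p → indicator p x ≡ 0
indicator-∉ {p = p} {x} x∉p with lookup p x in eq
... | true  = ⊥-elim (x∉p (lookup⇒[]= x p eq))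
... | false = refl

indicator-cong : ∀ {p q : Subset n} {x y} → x ∈ p ⇔ y ∈ q → indicator p x ≡ indicator q y
indicator-cong {p = p} {x = x} x∈p⇔y∈q with x ∈? p
... | yes x∈p = trans (indicator-∈ x∈p) (sym (indicator-∈ (to x∈p⇔y∈q x∈p)))
... | no  x∉p = trans (indicator-∉ x∉p) (sym (indicator-∉ (x∉p ∘ from x∈p⇔y∈q)))

∣p∣≡∣q∣-permute : ∀ {p q : Subset n} (π : Permutation′ n) → (∀ x → x ∈ p ⇔ (π ⟨$⟩ʳ x) ∈ q) → ∣ p ∣ ≡ ∣ q ∣
∣p∣≡∣q∣-permute {p = p} {q} π p≅q = begin
  ∣ p ∣                             ≡⟨ ∣p∣≡∑indicator p ⟩
  sum (indicator p)                 ≡⟨ sum-cong-≗ (λ x → indicator-cong (p≅q x)) ⟩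
  sum (indicator q ∘ (π ⟨$⟩ʳ_))     ≡⟨ ∑-permute (indicator q) π ⟨
  sum (indicator q)                 ≡⟨ ∣p∣≡∑indicator q ⟨
  ∣ q ∣                             ∎
  where open ≡-Reasoning

x∈p─q⇒x∉q : ∀ (p q : Subset n) {x} → x ∈ p ─ q → x ∉ q
x∈p─q⇒x∉q (_ ∷ p) (outside ∷ q) here          ()
x∈p─q⇒x∉q (_ ∷ p) (inside  ∷ q) {zero} ()
x∈p─q⇒x∉q (_ ∷ p) (_       ∷ q) (there x∈p─q) (there x∈q) = x∈p─q⇒x∉q p q x∈p─q x∈q

∣p∣≡∣p─q∣+∣p∩q∣ : (p q : Subset n) → ∣ p ∣ ≡ ∣ p ─ q ∣ + ∣ p ∩ q ∣
∣p∣≡∣p─q∣+∣p∩q∣ p q = begin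
  ∣ p ∣                                              ≡⟨ ∣p∣≡∑indicator p ⟩
  sum (indicator p)                                  ≡⟨ sum-cong-≗ split ⟩
  sum (λ x → indicator (p ─ q) x + indicator (p ∩ q) x) ≡⟨ ∑-distrib-+ (indicator (p ─ q)) (indicator (p ∩ q)) ⟩
  sum (indicator (p ─ q)) + sum (indicator (p ∩ q))  ≡⟨ cong₂ _+_ (∣p∣≡∑indicator (p ─ q)) (∣p∣≡∑indicator (p ∩ q)) ⟨
  ∣ p ─ q ∣ + ∣ p ∩ q ∣                              ∎
  where
  open ≡-Reasoning
  split : ∀ x → indicator p x ≡ indicator (p ─ q) x + indicator (p ∩ q) x
  split x with x ∈? p | x ∈? q
  ... | yes x∈p | yes x∈q = trans (indicator-∈ x∈p)
        (sym (cong₂ _+_ (indicator-∉ (λ x∈p─q → x∈p─q⇒x∉q p q x∈p─q x∈q)) (indicator-∈ (x∈p∩q⁺ (x∈p , x∈q)))))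
  ... | yes x∈p | no  x∉q = trans (indicator-∈ x∈p)
        (sym (cong₂ _+_ (indicator-∈ (x∈p∧x∉q⇒x∈p─q x∈p x∉q)) (indicator-∉ (x∉q ∘ proj₂ ∘ x∈p∩q⁻ p q))))
  ... | no  x∉p | _       = trans (indicator-∉ x∉p)
        (sym (cong₂ _+_ (indicator-∉ (x∉p ∘ p─q⊆p p q)) (indicator-∉ (x∉p ∘ proj₁ ∘ x∈p∩q⁻ p q))))

sum-∣∣-partition : ∀ {k} (P : Fin k → Subset n) (q : Subset n)
  → (∀ i → P i ⊆ q)
  → (∀ {y} → y ∈ q → ∃ λ i → y ∈ P i)
  → (∀ {y} i j → y ∈ P i → y ∈ P j → i ≡ j)
  → sum (λ i → ∣ P i ∣) ≡ ∣ q ∣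
sum-∣∣-partition P q P⊆q covering disjoint = begin
  sum (λ i → ∣ P i ∣)                          ≡⟨ sum-cong-≗ (λ i → ∣p∣≡∑indicator (P i)) ⟩
  sum (λ i → sum (indicator (P i)))            ≡⟨ ∑-comm (λ i → indicator (P i)) ⟩
  sum (λ y → sum (λ i → indicator (P i) y))    ≡⟨ sum-cong-≗ column ⟩
  sum (indicator q)                            ≡⟨ ∣p∣≡∑indicator q ⟨
  ∣ q ∣                                        ∎
  where
  open ≡-Reasoning
  column : ∀ y → sum (λ i → indicator (P i) y) ≡ indicator q y
  column y with y ∈? q
  ... | no  y∉q = trans (sum-zero _ (λ i → indicator-∉ (y∉q ∘ P⊆q i))) (sym (indicator-∉ y∉q))
  ... | yes y∈q with covering y∈q
  ...   | i , y∈Pi = trans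
          (sum-single _ i (indicator-∈ y∈Pi)
            (λ j j≢i → indicator-∉ (λ y∈Pj → j≢i (disjoint j i y∈Pj y∈Pi))))
          (sym (indicator-∈ y∈q))

x∈p⇒0<∣p∣ : ∀ {p : Subset n} {x} → x ∈ p → 0 < ∣ p ∣
x∈p⇒0<∣p∣ {p = p} {x} x∈p = ≤-trans (≤-reflexive (sym (∣⁅x⁆∣≡1 x)))
  (p⊆q⇒∣p∣≤∣q∣ (λ y∈⁅x⁆ → subst (_∈ p) (sym (x∈⁅y⁆⇒x≡y x y∈⁅x⁆)) x∈p))

Empty⇒∣p∣≡0 : ∀ {p : Subset n} → Empty p → ∣ p ∣ ≡ 0
Empty⇒∣p∣≡0 {n} p-empty rewrite Empty-unique p-empty = ∣⊥∣≡0 n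

Empty[p∩q]⇒∣p∣≡∣p─q∣ : (p q : Subset n) → Empty (p ∩ q) → ∣ p ∣ ≡ ∣ p ─ q ∣
Empty[p∩q]⇒∣p∣≡∣p─q∣ p q p∩q-empty = begin
  ∣ p ∣                   ≡⟨ ∣p∣≡∣p─q∣+∣p∩q∣ p q ⟩
  ∣ p ─ q ∣ + ∣ p ∩ q ∣   ≡⟨ cong (∣ p ─ q ∣ +_) (Empty⇒∣p∣≡0 p∩q-empty) ⟩
  ∣ p ─ q ∣ + 0           ≡⟨ +-identityʳ _ ⟩
  ∣ p ─ q ∣               ∎
  where open ≡-Reasoning

∣p∣≡∣p─q∣⇒Empty[p∩q] : (p q : Subset n) → ∣ p ∣ ≡ ∣ p ─ q ∣ → Empty (p ∩ q)
∣p∣≡∣p─q∣⇒Empty[p∩q] p q ∣p∣≡∣p─q∣ p∩q-nonempty = <-irrefl (sym ∣p∣≡∣p─q∣) (p∩q≢∅⇒∣p─q∣<∣p∣ p q p∩q-nonempty)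

∈-tabulate-does : ∀ {P : Pred (Fin n) 0ℓ} (P? : Decidable P) x → x ∈ tabulate (does ∘ P?) ⇔ P x
∈-tabulate-does {P = P} P? x = mk⇔ ∈⇒P P⇒∈
  where
  P⇒∈ : P x → x ∈ tabulate (does ∘ P?)
  P⇒∈ Px = lookup⇒[]= x _ (trans (lookup∘tabulate (does ∘ P?) x) (dec-true (P? x) Px))

  ∈⇒P : x ∈ tabulate (does ∘ P?) → P x
  ∈⇒P x∈ with P? x | trans (sym (lookup∘tabulate (does ∘ P?) x)) ([]=⇒lookup x∈)
  ... | yes Px | _ = Px

module _ (G : FinGroup) where
  open FinGroup G
  open IsGroup isGroup using (assoc; _\\_; _//_)

  group : Group 0ℓ 0ℓ
  group = record { isGroup = isGroup }

  open GroupProperties group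
    using (⁻¹-involutive; ⁻¹-anti-homo-∙; ⁻¹-anti-homo-\\; ⁻¹-anti-homo-//;
           \\-leftDividesˡ; \\-leftDividesʳ; //-rightDividesˡ; //-rightDividesʳ)

  x//y∙y//z≡x//z : ∀ x y z → (x // y) ∙ (y // z) ≡ x // z
  x//y∙y//z≡x//z x y z = trans (assoc x (y ⁻¹) (y // z)) (cong (x ∙_) (\\-leftDividesʳ y (z ⁻¹)))

  x∙y\\x≡y⁻¹ : ∀ x y → (x ∙ y) \\ x ≡ y ⁻¹
  x∙y\\x≡y⁻¹ x y = trans (cong (_∙ x) (⁻¹-anti-homo-∙ x y)) (//-rightDividesˡ x (y ⁻¹))

  x//y\\x≡y : ∀ x y → (x // y) \\ x ≡ y
  x//y\\x≡y x y = trans (cong (_∙ x) (⁻¹-anti-homo-// x y)) (//-rightDividesˡ x y)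

  x//[y\\x]≡y : ∀ x y → x // (y \\ x) ≡ y
  x//[y\\x]≡y x y = trans (cong (x ∙_) (⁻¹-anti-homo-\\ y x)) (\\-leftDividesˡ x y)

  module _ {H : Subset order} (H≤G : IsSubgroup G H) where

    ε∈H : ε ∈ H
    ε∈H = proj₁ H≤G

    ∙-closed : ∀ {a b} → a ∈ H → b ∈ H → a ∙ b ∈ H
    ∙-closed = proj₁ (proj₂ H≤G) _ _

    ⁻¹-closed : ∀ {a} → a ∈ H → a ⁻¹ ∈ H
    ⁻¹-closed = proj₂ (proj₂ H≤G) _

    ⁻¹-reflects : ∀ {a} → a ⁻¹ ∈ H → a ∈ H
    ⁻¹-reflects {a} a⁻¹∈H = subst (_∈ H) (⁻¹-involutive a) (⁻¹-closed a⁻¹∈H)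

    \\-closed : ∀ {a b} → a ∈ H → b ∈ H → a \\ b ∈ H
    \\-closed a∈H b∈H = ∙-closed (⁻¹-closed a∈H) b∈H

    //-sym : ∀ {a b} → a // b ∈ H → b // a ∈ H
    //-sym {a} {b} a//b∈H = subst (_∈ H) (⁻¹-anti-homo-// a b) (⁻¹-closed a//b∈H)

    //-trans : ∀ {a b c} → a // b ∈ H → b // c ∈ H → a // c ∈ H
    //-trans {a} {b} {c} a//b∈H b//c∈H = subst (_∈ H) (x//y∙y//z≡x//z a b c) (∙-closed a//b∈H b//c∈H)

    ∈-RightCoset : ∀ g y → y ∈ RightCoset G H g ⇔ y // g ∈ H
    ∈-RightCoset g = ∈-tabulate-does (λ y → (y // g) ∈? H)

    RightCoset-cong : ∀ {g g′} → g // g′ ∈ H → RightCoset G H g ≡ RightCoset G H g′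
    RightCoset-cong {g} {g′} g//g′∈H = ⊆-antisym
      (λ {y} y∈Hg → from (∈-RightCoset g′ y) (//-trans (to (∈-RightCoset g y) y∈Hg) g//g′∈H))
      (λ {y} y∈Hg′ → from (∈-RightCoset g y) (//-trans (to (∈-RightCoset g′ y) y∈Hg′) (//-sym g//g′∈H)))

    module _ (S : Subset order) where

      RegularityCriterion : ℕ → Set
      RegularityCriterion k = (Empty (S ∩ H) × suc k ≡ 2) ⊎ suc k ≡ 1

      ∈-neighbours : ∀ u v → v ∈ neighbours G H S u ⇔ Adj G H S u v
      ∈-neighbours u = ∈-tabulate-does (Adj? G H S u)

      ∈-neighbours-∈H : Symmetric G (S ∩ H) → ∀ {h} → h ∈ H → ∀ v → v ∈ neighbours G H S h ⇔ h \\ v ∈ S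
      ∈-neighbours-∈H S∩H-sym {h} h∈H v = mk⇔ (adjacent ∘ to (∈-neighbours h v)) (λ h\\v∈S →
        from (∈-neighbours h v) (inj₁ (h∈H , h \\ v , h\\v∈S , sym (\\-leftDividesˡ h v))))
        where
        adjacent : Adj G H S h v → h \\ v ∈ S
        adjacent (inj₁ (_ , s , s∈S , v≡h∙s)) =
          subst (_∈ S) (sym (trans (cong (h \\_) v≡h∙s) (\\-leftDividesʳ h s))) s∈S
        adjacent (inj₂ (v∈H , s , s∈S , h≡v∙s)) =
          subst (_∈ S) (sym (trans (cong (_\\ v) h≡v∙s) (x∙y\\x≡y⁻¹ v s)))
            (proj₁ (x∈p∩q⁻ S H (proj₁ (S∩H-sym s) (x∈p∩q⁺ (s∈S , s∈H)))))
          where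
          s∈H : s ∈ H
          s∈H = subst (_∈ H) (trans (cong (v \\_) h≡v∙s) (\\-leftDividesʳ v s)) (\\-closed v∈H h∈H)

      ∈-neighbours-∉H : ∀ {g} → g ∉ H → ∀ v → v ∈ neighbours G H S g ⇔ v \\ g ∈ RightCoset G H g ∩ (S ─ H)
      ∈-neighbours-∉H {g} g∉H v = mk⇔
        (adjacent ∘ to (∈-neighbours g v))
        (from (∈-neighbours g v) ∘ inj₂ ∘ reverse)
        where
        v\\g∈Hg⇔v∈H : v \\ g ∈ RightCoset G H g ⇔ v ∈ H
        v\\g∈Hg⇔v∈H = mk⇔
          (λ ∈Hg → ⁻¹-reflects (subst (_∈ H) (//-rightDividesʳ g (v ⁻¹)) (to (∈-RightCoset g _) ∈Hg)))
          (λ v∈H → from (∈-RightCoset g _) (subst (_∈ H) (sym (//-rightDividesʳ g (v ⁻¹))) (⁻¹-closed v∈H)))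

        adjacent : Adj G H S g v → v \\ g ∈ RightCoset G H g ∩ (S ─ H)
        adjacent (inj₁ (g∈H , _)) = ⊥-elim (g∉H g∈H)
        adjacent (inj₂ (v∈H , s , s∈S , g≡v∙s)) = x∈p∩q⁺ (from v\\g∈Hg⇔v∈H v∈H , x∈p∧x∉q⇒x∈p─q v\\g∈S v\\g∉H)
          where
          v\\g∈S : v \\ g ∈ S
          v\\g∈S = subst (_∈ S) (sym (trans (cong (v \\_) g≡v∙s) (\\-leftDividesʳ v s))) s∈S
          v\\g∉H : v \\ g ∉ H
          v\\g∉H v\\g∈H = g∉H (subst (_∈ H) (\\-leftDividesˡ v g) (∙-closed v∈H v\\g∈H))

        reverse : v \\ g ∈ RightCoset G H g ∩ (S ─ H) → v ∈ H × ∃ λ s → s ∈ S × g ≡ v ∙ s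
        reverse v\\g∈ with x∈p∩q⁻ (RightCoset G H g) (S ─ H) v\\g∈
        ... | ∈Hg , ∈S─H = to v\\g∈Hg⇔v∈H ∈Hg , v \\ g , p─q⊆p S H ∈S─H , sym (\\-leftDividesˡ v g)

      deg-∈H : Symmetric G (S ∩ H) → ∀ h → h ∈ H → deg G H S h ≡ ∣ S ∣
      deg-∈H S∩H-sym h h∈H = ∣p∣≡∣q∣-permute
        (permutation (h \\_) (h ∙_) (\\-leftDividesʳ h) (\\-leftDividesˡ h))
        (∈-neighbours-∈H S∩H-sym h∈H)

      deg-∉H : ∀ g → g ∉ H → deg G H S g ≡ ∣ RightCoset G H g ∩ (S ─ H) ∣
      deg-∉H g g∉H = ∣p∣≡∣q∣-permute
        (permutation (_\\ g) (g //_) (x//y\\x≡y g) (x//[y\\x]≡y g))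
        (∈-neighbours-∉H g∉H)

      deg-cong-∉H : ∀ {g g′} → g ∉ H → g′ ∉ H → g // g′ ∈ H → deg G H S g ≡ deg G H S g′
      deg-cong-∉H {g} {g′} g∉H g′∉H g//g′∈H = begin
        deg G H S g                       ≡⟨ deg-∉H g g∉H ⟩
        ∣ RightCoset G H g ∩ (S ─ H) ∣    ≡⟨ cong (λ C → ∣ C ∩ (S ─ H) ∣) (RightCoset-cong g//g′∈H) ⟩
        ∣ RightCoset G H g′ ∩ (S ─ H) ∣   ≡⟨ deg-∉H g′ g′∉H ⟨
        deg G H S g′                      ∎
        where open ≡-Reasoning

      module _ {k : ℕ} {x : Fin k → Fin order} (reps : NontrivialRightCosetReps G H k x) where

        Σ∣Hxᵢ∩[S─H]∣≡∣S─H∣ : Σ[< k ] (λ i → ∣ RightCoset G H (x i) ∩ (S ─ H) ∣) ≡ ∣ S ─ H ∣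
        Σ∣Hxᵢ∩[S─H]∣≡∣S─H∣ = trans (Σ[<]≡sum (λ i → ∣ RightCoset G H (x i) ∩ (S ─ H) ∣))
          (sum-∣∣-partition (λ i → RightCoset G H (x i) ∩ (S ─ H)) (S ─ H)
            (λ i → proj₂ ∘ x∈p∩q⁻ _ _) covering disjoint)
          where
          same-coset⇒i≡j : ∀ i j → x i // x j ∈ H → i ≡ j
          same-coset⇒i≡j = proj₁ (proj₂ reps)

          covers : ∀ g → g ∉ H → ∃ λ i → g // x i ∈ H
          covers = proj₂ (proj₂ reps)

          covering : ∀ {y} → y ∈ S ─ H → ∃ λ i → y ∈ RightCoset G H (x i) ∩ (S ─ H)
          covering {y} y∈S─H with covers y (x∈p─q⇒x∉q S H y∈S─H)
          ... | i , y//xᵢ∈H = i , x∈p∩q⁺ (from (∈-RightCoset (x i) y) y//xᵢ∈H , y∈S─H)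

          disjoint : ∀ {y} i j → y ∈ RightCoset G H (x i) ∩ (S ─ H) → y ∈ RightCoset G H (x j) ∩ (S ─ H) → i ≡ j
          disjoint {y} i j y∈Hxᵢ y∈Hxⱼ = same-coset⇒i≡j i j (//-trans
            (//-sym (to (∈-RightCoset (x i) y) (proj₁ (x∈p∩q⁻ _ _ y∈Hxᵢ))))
            (to (∈-RightCoset (x j) y) (proj₁ (x∈p∩q⁻ _ _ y∈Hxⱼ))))

        ∣S─H∣≡Σdeg : ∣ S ─ H ∣ ≡ Σ[< k ] (λ i → deg G H S (x i))
        ∣S─H∣≡Σdeg = trans (sym Σ∣Hxᵢ∩[S─H]∣≡∣S─H∣)
          (cong sumᴸ (tabulate-cong (λ i → sym (deg-∉H (x i) (proj₁ reps i)))))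

      index2⇒deg≡∣S─H∣ : ∀ {x} → NontrivialRightCosetReps G H 1 x → deg G H S (x zero) ≡ ∣ S ─ H ∣
      index2⇒deg≡∣S─H∣ reps = sym (trans (∣S─H∣≡Σdeg reps) (+-identityʳ _))

      regular⇒criterion : Symmetric G (S ∩ H) → Nonempty S
        → ∀ {k x} → NontrivialRightCosetReps G H k x
        → Regular G H S → RegularityCriterion k
      regular⇒criterion _ _ {zero} _ _ = inj₂ refl
      regular⇒criterion S∩H-sym _ {suc zero} {x} reps regular =
        inj₁ (∣p∣≡∣p─q∣⇒Empty[p∩q] S H ∣S∣≡∣S─H∣ , refl)
        where
        open ≡-Reasoning
        ∣S∣≡∣S─H∣ : ∣ S ∣ ≡ ∣ S ─ H ∣
        ∣S∣≡∣S─H∣ = begin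
          ∣ S ∣                      ≡⟨ deg-∈H S∩H-sym ε ε∈H ⟨
          deg G H S ε                ≡⟨ regular ε (x zero) ⟩
          deg G H S (x zero)         ≡⟨ index2⇒deg≡∣S─H∣ reps ⟩
          ∣ S ─ H ∣                  ∎
      regular⇒criterion S∩H-sym (_ , s∈S) {suc (suc k)} {x} reps regular =
        ⊥-elim (<-irrefl refl (<-≤-trans (m<m+n ∣ S ∣ (x∈p⇒0<∣p∣ s∈S)) two-degrees≤∣S∣))
        where
        open ≤-Reasoning
        deg-xᵢ≡∣S∣ : ∀ i → deg G H S (x i) ≡ ∣ S ∣
        deg-xᵢ≡∣S∣ i = trans (regular (x i) ε) (deg-∈H S∩H-sym ε ε∈H)

        two-degrees≤∣S∣ : ∣ S ∣ + ∣ S ∣ ≤ ∣ S ∣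
        two-degrees≤∣S∣ = begin
          ∣ S ∣ + ∣ S ∣                                   ≡⟨ cong₂ _+_ (deg-xᵢ≡∣S∣ zero) (deg-xᵢ≡∣S∣ (suc zero)) ⟨
          deg G H S (x zero) + deg G H S (x (suc zero))   ≤⟨ +-monoʳ-≤ (deg G H S (x zero)) (m≤m+n _ _) ⟩
          Σ[< suc (suc k) ] (λ i → deg G H S (x i))       ≡⟨ ∣S─H∣≡Σdeg reps ⟨
          ∣ S ─ H ∣                                       ≤⟨ ∣p─q∣≤∣p∣ S H ⟩
          ∣ S ∣                                           ∎

      -- The decision is an argument because `with u ∈? H` would also abstract the u ∈? H inside deg.
      criterion⇒deg≡∣S∣ : Symmetric G (S ∩ H)
        → ∀ {k x} → NontrivialRightCosetReps G H k x
        → RegularityCriterion k → ∀ u → Dec (u ∈ H) → deg G H S u ≡ ∣ S ∣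
      criterion⇒deg≡∣S∣ S∩H-sym _ _ u (yes u∈H) = deg-∈H S∩H-sym u u∈H
      criterion⇒deg≡∣S∣ _ (_ , _ , covers) (inj₂ refl) u (no u∉H) with covers u u∉H
      ... | () , _
      criterion⇒deg≡∣S∣ _ {x = x} reps@(xᵢ∉H , _ , covers) (inj₁ (S∩H-empty , refl)) u (no u∉H)
        with covers u u∉H
      ... | zero , u//x₀∈H = begin
        deg G H S u               ≡⟨ deg-cong-∉H u∉H (xᵢ∉H zero) u//x₀∈H ⟩
        deg G H S (x zero)        ≡⟨ index2⇒deg≡∣S─H∣ reps ⟩
        ∣ S ─ H ∣                 ≡⟨ Empty[p∩q]⇒∣p∣≡∣p─q∣ S H S∩H-empty ⟨
        ∣ S ∣                     ∎
        where open ≡-Reasoning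

      criterion⇒regular : Symmetric G (S ∩ H)
        → ∀ {k x} → NontrivialRightCosetReps G H k x
        → RegularityCriterion k → Regular G H S
      criterion⇒regular S∩H-sym reps criterion u v = trans (deg≡∣S∣ u) (sym (deg≡∣S∣ v))
        where
        deg≡∣S∣ : ∀ u → deg G H S u ≡ ∣ S ∣
        deg≡∣S∣ u = criterion⇒deg≡∣S∣ S∩H-sym reps criterion u (u ∈? H)

corollary2p11 : (G : FinGroup) (H S : Subset (FinGroup.order G))
    → IsSubgroup G H
    → Symmetric G (S ∩ H)
    → (k : ℕ) (x : Fin k → Fin (FinGroup.order G))
    → NontrivialRightCosetReps G H k x
    → (∀ h → h ∈ H → deg G H S h ≡ ∣ S ∣)
      × (Σ[< k ] (λ i → ∣ RightCoset G H (x i) ∩ (S ─ H) ∣) ≤ ∣ S ∣)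
      × (Σ[< k ] (λ i → ∣ RightCoset G H (x i) ∩ (S ─ H) ∣) ≡ ∣ S ─ H ∣)
      × (∣ S ─ H ∣ ≡ Σ[< k ] (λ i → deg G H S (x i)))
      × (∣ S ∣ ≡ Σ[< k ] (λ i → ∣ RightCoset G H (x i) ∩ (S ─ H) ∣) → Empty (S ∩ H))
      × (Nonempty S → (Regular G H S ⇔ ((Empty (S ∩ H) × suc k ≡ 2) ⊎ suc k ≡ 1)))
corollary2p11 G H S H≤G S∩H-sym k x reps =
    deg-∈H G H≤G S S∩H-sym
  , ≤-trans (≤-reflexive Σ≡∣S─H∣) (∣p─q∣≤∣p∣ S H)
  , Σ≡∣S─H∣
  , ∣S─H∣≡Σdeg G H≤G S reps
  , (λ ∣S∣≡Σ → ∣p∣≡∣p─q∣⇒Empty[p∩q] S H (trans ∣S∣≡Σ Σ≡∣S─H∣))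
  , λ S-nonempty → mk⇔
      (regular⇒criterion G H≤G S S∩H-sym S-nonempty reps)
      (criterion⇒regular G H≤G S S∩H-sym reps)
  where
  Σ≡∣S─H∣ : Σ[< k ] (λ i → ∣ RightCoset G H (x i) ∩ (S ─ H) ∣) ≡ ∣ S ─ H ∣
  Σ≡∣S─H∣ = Σ∣Hxᵢ∩[S─H]∣≡∣S─H∣ G H≤G S reps
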